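{- An algebra $(S,\sqcup,\cap)$ with two binary operations is an ado-semilattice if and only if: (1) $(S,\sqcup)$ is a left regular band; (2) with respect to the partial order defined by $a\le b$ iff $a\sqcup b=b$, $a\cap b$ is the greatest lower bound of $a$ and $b$ for all $a,b$; (3) $a\sqcup(b\cap c)=(a\sqcup b)\cap(a\sqcup c)$ for all $a,b,c$; (4) $a\cap c\le(a\cap b)\sqcup c$ for all $a,b,c$.
   Context: An ado-semilattice is an algebra $(S,\sqcup,\cap)$ such that $(S,\cap)$ is a semilattice and, writing $x\le y$ iff $x=x\cap y$, for all $x,y,z,d$: (i) $x\le x\sqcup y$; (ii) $(x\cap y)\sqcup(y\cap z)\le y$; (iii) $x\sqcup y\le x\sqcup(y\cap(x\sqcup y))$; (iv) $x\cap z\le(x\cap y)\sqcup z$; (v) $(x\cap d)\sqcup((y\cap d)\cap(z\cap d))=((x\cap d)\sqcup(y\cap d))\cap((x\cap d)\sqcup(z\cap d))$; (vi) $\sqcup$ is associative. A left regular band is an algebra $(S,\sqcup)$ with $\sqcup$ associative, $a\sqcup a=a$, and $a\sqcup b=(a\sqcup b)\sqcup a$. -}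

module Defs where

open import Level using (Level)
open import Data.Product using (_×_)
open import Relation.Binary.PropositionalEquality using (_≡_)
open import Algebra.Core using (Op₂)

module _ {ℓ : Level} {S : Set ℓ} where

  record IsMeetSemilattice (_∩_ : Op₂ S) : Set ℓ where
    field
      ∩-assoc : ∀ x y z → (x ∩ y) ∩ z ≡ x ∩ (y ∩ z)
      ∩-comm  : ∀ x y → x ∩ y ≡ y ∩ x
      ∩-idem  : ∀ x → x ∩ x ≡ x

  _≤∩[_]_ : S → Op₂ S → S → Set ℓ
  x ≤∩[ _∩_ ] y = x ≡ x ∩ y

  -- ado-semilattice, axioms (i)-(vi) verbatim
  record IsAdoSemilattice (_⊔_ _∩_ : Op₂ S) : Set ℓ where
    field
      isMeetSemilattice : IsMeetSemilattice _∩_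
      ax-i   : ∀ x y → x ≤∩[ _∩_ ] (x ⊔ y)
      ax-ii  : ∀ x y z → ((x ∩ y) ⊔ (y ∩ z)) ≤∩[ _∩_ ] y
      ax-iii : ∀ x y → (x ⊔ y) ≤∩[ _∩_ ] (x ⊔ (y ∩ (x ⊔ y)))
      ax-iv  : ∀ x y z → (x ∩ z) ≤∩[ _∩_ ] ((x ∩ y) ⊔ z)
      ax-v   : ∀ x y z d →
                 (x ∩ d) ⊔ ((y ∩ d) ∩ (z ∩ d))
                   ≡ ((x ∩ d) ⊔ (y ∩ d)) ∩ ((x ∩ d) ⊔ (z ∩ d))
      ax-vi  : ∀ x y z → (x ⊔ y) ⊔ z ≡ x ⊔ (y ⊔ z)

  record IsLeftRegularBand (_⊔_ : Op₂ S) : Set ℓ where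
    field
      ⊔-assoc : ∀ x y z → (x ⊔ y) ⊔ z ≡ x ⊔ (y ⊔ z)
      ⊔-idem  : ∀ a → a ⊔ a ≡ a
      ⊔-lreg  : ∀ a b → a ⊔ b ≡ (a ⊔ b) ⊔ a

  _≤⊔[_]_ : S → Op₂ S → S → Set ℓ
  a ≤⊔[ _⊔_ ] b = (a ⊔ b) ≡ b

  IsGLB⊔ : Op₂ S → S → S → S → Set ℓ
  IsGLB⊔ _⊔_ a b m =
    (m ≤⊔[ _⊔_ ] a) × (m ≤⊔[ _⊔_ ] b) ×
    (∀ c → c ≤⊔[ _⊔_ ] a → c ≤⊔[ _⊔_ ] b → c ≤⊔[ _⊔_ ] m)

  record Cor33Conditions (_⊔_ _∩_ : Op₂ S) : Set ℓ where
    field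
      cond1 : IsLeftRegularBand _⊔_
      cond2 : ∀ a b → IsGLB⊔ _⊔_ a b (a ∩ b)
      cond3 : ∀ a b c → a ⊔ (b ∩ c) ≡ (a ⊔ b) ∩ (a ⊔ c)
      cond4 : ∀ a b c → (a ∩ c) ≤⊔[ _⊔_ ] ((a ∩ b) ⊔ c)

{-# OPTIONS --safe #-}
-- The two orders x = x ∩ y and x ⊔ y = y coincide: axiom (ii) with x ≤ y gives
-- x ⊔ y ≤ y, axiom (iv) gives y ≤ x ⊔ y, and (i) gives the converse. Axiom (v)
-- says that ⊔ distributes over ∩ inside every principal down-set ↓d; with d = q
-- it yields left regularity, and with d = (a ⊔ b) ∩ (a ⊔ c), together with the
-- absorption law a ⊔ (b ∩ (a ⊔ b)) = a ⊔ b supplied by (iii), it yields full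
-- distributivity (3). Conversely (1)-(4) make ∩ the meet of a partial order, and
-- (i)-(vi) are then immediate.
module Submission where

open import Defs
open import Level using (Level)
open import Algebra.Core using (Op₂)
open import Algebra.Lattice.Bundles using (Semilattice)
import Algebra.Lattice.Properties.Semilattice as SemilatticeProperties
open import Data.Product using (_,_)
open import Function.Bundles using (_⇔_; mk⇔)
open import Relation.Binary.Core using (Rel)
open import Relation.Binary.Lattice using (MeetSemilattice)
import Relation.Binary.Lattice.Properties.MeetSemilattice as MeetSemilatticeProperties
open import Relation.Binary.Structures using (IsPartialOrder)
open import Relation.Binary.PropositionalEquality
  using (_≡_; refl; sym; trans; cong; cong₂; subst; subst₂; isEquivalence;
         module ≡-Reasoning)

module _ {c ℓ₁ ℓ₂} (M : MeetSemilattice c ℓ₁ ℓ₂) where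
  open MeetSemilattice M using (_≈_; _≤_; _∧_; antisym; ∧-greatest; x∧y≤x)
    renaming (refl to ≤-refl)

  x≤y⇒x≈x∧y : ∀ {x y} → x ≤ y → x ≈ x ∧ y
  x≤y⇒x≈x∧y x≤y = antisym (∧-greatest ≤-refl x≤y) (x∧y≤x _ _)

module LeftRegularBandProperties {ℓ : Level} {S : Set ℓ} {_⊔_ : Op₂ S}
                                 (lrb : IsLeftRegularBand _⊔_) where
  open IsLeftRegularBand lrb

  _≤_ : Rel S ℓ
  a ≤ b = a ≤⊔[ _⊔_ ] b

  ≤-isPartialOrder : IsPartialOrder _≡_ _≤_
  ≤-isPartialOrder = record
    { isPreorder = record
      { isEquivalence = isEquivalence
      ; reflexive     = λ { {a} refl → ⊔-idem a }
      ; trans         = ≤-trans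
      }
    ; antisym = ≤-antisym
    }
    where
    ≤-trans : ∀ {a b c} → a ≤ b → b ≤ c → a ≤ c
    ≤-trans {a} {b} {c} a≤b b≤c = begin
      a ⊔ c        ≡⟨ cong (a ⊔_) b≤c ⟨
      a ⊔ (b ⊔ c)  ≡⟨ ⊔-assoc a b c ⟨
      (a ⊔ b) ⊔ c  ≡⟨ cong (_⊔ c) a≤b ⟩
      b ⊔ c        ≡⟨ b≤c ⟩
      c            ∎
      where open ≡-Reasoning

    ≤-antisym : ∀ {a b} → a ≤ b → b ≤ a → a ≡ b
    ≤-antisym {a} {b} a≤b b≤a = begin
      a            ≡⟨ b≤a ⟨
      b ⊔ a        ≡⟨ cong (_⊔ a) a≤b ⟨
      (a ⊔ b) ⊔ a  ≡⟨ ⊔-lreg a b ⟨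
      a ⊔ b        ≡⟨ a≤b ⟩
      b            ∎
      where open ≡-Reasoning

  x≤x⊔y : ∀ x y → x ≤ (x ⊔ y)
  x≤x⊔y x y = trans (sym (⊔-assoc x x y)) (cong (_⊔ y) (⊔-idem x))

  ⊔-lub : ∀ {p q r} → p ≤ r → q ≤ r → (p ⊔ q) ≤ r
  ⊔-lub {p} {q} {r} p≤r q≤r = trans (⊔-assoc p q r) (trans (cong (p ⊔_) q≤r) p≤r)

  ⊔-monoʳ-≤ : ∀ a {p q} → p ≤ q → (a ⊔ p) ≤ (a ⊔ q)
  ⊔-monoʳ-≤ a {p} {q} p≤q = begin
    (a ⊔ p) ⊔ (a ⊔ q)  ≡⟨ ⊔-assoc (a ⊔ p) a q ⟨
    ((a ⊔ p) ⊔ a) ⊔ q  ≡⟨ cong (_⊔ q) (⊔-lreg a p) ⟨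
    (a ⊔ p) ⊔ q        ≡⟨ ⊔-assoc a p q ⟩
    a ⊔ (p ⊔ q)        ≡⟨ cong (a ⊔_) p≤q ⟩
    a ⊔ q              ∎
    where open ≡-Reasoning

module AdoSemilatticeProperties {ℓ : Level} {S : Set ℓ} {_⊔_ _∩_ : Op₂ S}
                                (ado : IsAdoSemilattice _⊔_ _∩_) where
  open IsAdoSemilattice ado
  open IsMeetSemilattice isMeetSemilattice
  open ≡-Reasoning

  ∩-semilattice : Semilattice ℓ ℓ
  ∩-semilattice = record
    { _≈_           = _≡_
    ; _∙_           = _∩_
    ; isSemilattice = record
      { isBand = record
        { isSemigroup = record
          { isMagma = record { isEquivalence = isEquivalence ; ∙-cong = cong₂ _∩_ }
          ; assoc   = ∩-assoc
          }
        ; idem = ∩-idem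
        }
      ; comm = ∩-comm
      }
    }

  ∩-meetSemilattice : MeetSemilattice ℓ ℓ ℓ
  ∩-meetSemilattice =
    SemilatticeProperties.∧-orderTheoreticMeetSemilattice ∩-semilattice

  open MeetSemilattice ∩-meetSemilattice
    using (_≤_; antisym; x∧y≤x; x∧y≤y; ∧-greatest) renaming (refl to ≤-refl)
  open MeetSemilatticeProperties ∩-meetSemilattice using (∧-monotonic; y≤x⇒x∧y≈y)

  x≤y⇒x⊔y≡y : ∀ {x y} → x ≤ y → x ⊔ y ≡ y
  x≤y⇒x⊔y≡y {x} {y} x≤y = antisym x⊔y≤y y≤x⊔y
    where
    x⊔y≤y : (x ⊔ y) ≤ y
    x⊔y≤y = subst (_≤ y) (cong₂ _⊔_ (sym x≤y) (∩-idem y)) (ax-ii x y y)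

    y≤x⊔y : y ≤ (x ⊔ y)
    y≤x⊔y = subst₂ _≤_ (∩-idem y) (cong (_⊔ y) (trans (∩-comm y x) (sym x≤y)))
                       (ax-iv y x y)

  x⊔y≡y⇒x≤y : ∀ {x y} → x ⊔ y ≡ y → x ≤ y
  x⊔y≡y⇒x≤y {x} e = subst (x ≤_) e (ax-i x _)

  ⊔-idem : ∀ x → x ⊔ x ≡ x
  ⊔-idem x = x≤y⇒x⊔y≡y ≤-refl

  ⊔-distribˡ-∩-below : ∀ {a b c d} → a ≤ d → b ≤ d → c ≤ d →
                       a ⊔ (b ∩ c) ≡ (a ⊔ b) ∩ (a ⊔ c)
  ⊔-distribˡ-∩-below {a} {b} {c} {d} a≤d b≤d c≤d = begin
    a ⊔ (b ∩ c)
      ≡⟨ cong₂ _⊔_ a≤d (cong₂ _∩_ b≤d c≤d) ⟩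
    (a ∩ d) ⊔ ((b ∩ d) ∩ (c ∩ d))
      ≡⟨ ax-v a b c d ⟩
    ((a ∩ d) ⊔ (b ∩ d)) ∩ ((a ∩ d) ⊔ (c ∩ d))
      ≡⟨ cong₂ _∩_ (cong₂ _⊔_ a≤d b≤d) (cong₂ _⊔_ a≤d c≤d) ⟨
    (a ⊔ b) ∩ (a ⊔ c)
      ∎

  y≤x⇒x⊔y≡x : ∀ {p q} → p ≤ q → q ⊔ p ≡ q
  y≤x⇒x⊔y≡x {p} {q} p≤q = antisym q⊔p≤q (ax-i q p)
    where
    q⊔p≤q : (q ⊔ p) ≤ q
    q⊔p≤q = begin
      q ⊔ p              ≡⟨ cong (q ⊔_) p≤q ⟩
      q ⊔ (p ∩ q)        ≡⟨ ⊔-distribˡ-∩-below ≤-refl p≤q ≤-refl ⟩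
      (q ⊔ p) ∩ (q ⊔ q)  ≡⟨ cong ((q ⊔ p) ∩_) (⊔-idem q) ⟩
      (q ⊔ p) ∩ q        ∎

  isLeftRegularBand : IsLeftRegularBand _⊔_
  isLeftRegularBand = record
    { ⊔-assoc = ax-vi
    ; ⊔-idem  = ⊔-idem
    ; ⊔-lreg  = λ a b → sym (y≤x⇒x⊔y≡x (ax-i a b))
    }

  ⊔-monoʳ-≤ : ∀ a {p q} → p ≤ q → (a ⊔ p) ≤ (a ⊔ q)
  ⊔-monoʳ-≤ a p≤q = x⊔y≡y⇒x≤y (LRB.⊔-monoʳ-≤ a (x≤y⇒x⊔y≡y p≤q))
    where module LRB = LeftRegularBandProperties isLeftRegularBand

  ⊔-∩-absorb : ∀ a b → a ⊔ (b ∩ (a ⊔ b)) ≡ a ⊔ b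
  ⊔-∩-absorb a b = antisym (⊔-monoʳ-≤ a (x∧y≤x b (a ⊔ b))) (ax-iii a b)

  ⊔-∩-between : ∀ {a b d} → a ≤ d → d ≤ (a ⊔ b) → a ⊔ (b ∩ d) ≡ d
  ⊔-∩-between {a} {b} {d} a≤d d≤a⊔b = begin
    a ⊔ (b ∩ d)
      ≡⟨ cong (λ t → a ⊔ (b ∩ t)) a⊔b∩d≡d ⟨
    a ⊔ (b ∩ ((a ⊔ b) ∩ d))
      ≡⟨ cong (a ⊔_) (∩-assoc b (a ⊔ b) d) ⟨
    a ⊔ ((b ∩ (a ⊔ b)) ∩ d)
      ≡⟨ ⊔-distribˡ-∩-below (ax-i a b) (x∧y≤y b (a ⊔ b)) d≤a⊔b ⟩
    (a ⊔ (b ∩ (a ⊔ b))) ∩ (a ⊔ d)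
      ≡⟨ cong₂ _∩_ (⊔-∩-absorb a b) (x≤y⇒x⊔y≡y a≤d) ⟩
    (a ⊔ b) ∩ d
      ≡⟨ a⊔b∩d≡d ⟩
    d ∎
    where
    a⊔b∩d≡d : (a ⊔ b) ∩ d ≡ d
    a⊔b∩d≡d = y≤x⇒x∧y≈y d≤a⊔b

  ⊔-distribˡ-∩ : ∀ a b c → a ⊔ (b ∩ c) ≡ (a ⊔ b) ∩ (a ⊔ c)
  ⊔-distribˡ-∩ a b c = antisym
    (∧-greatest (⊔-monoʳ-≤ a (x∧y≤x b c)) (⊔-monoʳ-≤ a (x∧y≤y b c)))
    (subst (_≤ a ⊔ (b ∩ c)) a⊔[b∩d∩c∩d]≡d
      (⊔-monoʳ-≤ a (∧-monotonic (x∧y≤x b d) (x∧y≤x c d))))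
    where
    d : S
    d = (a ⊔ b) ∩ (a ⊔ c)

    a≤d : a ≤ d
    a≤d = ∧-greatest (ax-i a b) (ax-i a c)

    a⊔[b∩d∩c∩d]≡d : a ⊔ ((b ∩ d) ∩ (c ∩ d)) ≡ d
    a⊔[b∩d∩c∩d]≡d = begin
      a ⊔ ((b ∩ d) ∩ (c ∩ d))
        ≡⟨ ⊔-distribˡ-∩-below a≤d (x∧y≤y b d) (x∧y≤y c d) ⟩
      (a ⊔ (b ∩ d)) ∩ (a ⊔ (c ∩ d))
        ≡⟨ cong₂ _∩_ (⊔-∩-between a≤d (x∧y≤x _ _)) (⊔-∩-between a≤d (x∧y≤y _ _)) ⟩
      d ∩ d
        ≡⟨ ∩-idem d ⟩
      d ∎

  cor33Conditions : Cor33Conditions _⊔_ _∩_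
  cor33Conditions = record
    { cond1 = isLeftRegularBand
    ; cond2 = λ a b → x≤y⇒x⊔y≡y (x∧y≤x a b) , x≤y⇒x⊔y≡y (x∧y≤y a b)
                    , λ c c≤a c≤b →
                        x≤y⇒x⊔y≡y (∧-greatest (x⊔y≡y⇒x≤y c≤a) (x⊔y≡y⇒x≤y c≤b))
    ; cond3 = ⊔-distribˡ-∩
    ; cond4 = λ a b c → x≤y⇒x⊔y≡y (ax-iv a b c)
    }

module Cor33ConditionsProperties {ℓ : Level} {S : Set ℓ} {_⊔_ _∩_ : Op₂ S}
                                 (conds : Cor33Conditions _⊔_ _∩_) where
  open Cor33Conditions conds
  open LeftRegularBandProperties cond1

  ∩-meetSemilattice : MeetSemilattice ℓ ℓ ℓ
  ∩-meetSemilattice = record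
    { isMeetSemilattice = record { isPartialOrder = ≤-isPartialOrder ; infimum = cond2 } }

  open MeetSemilattice ∩-meetSemilattice using (reflexive; x∧y≤x; x∧y≤y)
  open MeetSemilatticeProperties ∩-meetSemilattice using (∧-assoc; ∧-comm; ∧-idempotent)

  ≤⇒≤∩ : ∀ {a b} → a ≤ b → a ≤∩[ _∩_ ] b
  ≤⇒≤∩ = x≤y⇒x≈x∧y ∩-meetSemilattice

  ⊔-∩-absorb : ∀ a b → a ⊔ (b ∩ (a ⊔ b)) ≡ a ⊔ b
  ⊔-∩-absorb a b = begin
    a ⊔ (b ∩ (a ⊔ b))        ≡⟨ cond3 a b (a ⊔ b) ⟩
    (a ⊔ b) ∩ (a ⊔ (a ⊔ b))  ≡⟨ cong ((a ⊔ b) ∩_) (x≤x⊔y a b) ⟩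
    (a ⊔ b) ∩ (a ⊔ b)        ≡⟨ ∧-idempotent (a ⊔ b) ⟩
    a ⊔ b                    ∎
    where open ≡-Reasoning

  isAdoSemilattice : IsAdoSemilattice _⊔_ _∩_
  isAdoSemilattice = record
    { isMeetSemilattice = record
      { ∩-assoc = ∧-assoc ; ∩-comm = ∧-comm ; ∩-idem = ∧-idempotent }
    ; ax-i   = λ x y → ≤⇒≤∩ (x≤x⊔y x y)
    ; ax-ii  = λ x y z → ≤⇒≤∩ (⊔-lub (x∧y≤y x y) (x∧y≤x y z))
    ; ax-iii = λ x y → ≤⇒≤∩ (reflexive (sym (⊔-∩-absorb x y)))
    ; ax-iv  = λ x y z → ≤⇒≤∩ (cond4 x y z)
    ; ax-v   = λ x y z d → cond3 (x ∩ d) (y ∩ d) (z ∩ d)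
    ; ax-vi  = IsLeftRegularBand.⊔-assoc cond1
    }

corollary3p3 : {ℓ : Level} {S : Set ℓ} (_⊔_ _∩_ : Op₂ S) →
                 IsAdoSemilattice _⊔_ _∩_ ⇔ Cor33Conditions _⊔_ _∩_
corollary3p3 _⊔_ _∩_ =
  mk⇔ AdoSemilatticeProperties.cor33Conditions Cor33ConditionsProperties.isAdoSemilattice
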